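{- Let $I$ be a finite index set, $\{S_i\}_{i\in I}$ communicating systems $S_i=(M_x)_{x\in\mathbf P_i}$ with pairwise disjoint $\mathbf P_i$, $H=\{h_i\}_{i\in I}$ a set of interfaces ($h_i\in\mathbf P_i$), $\mathbb K=(M_{k_i})_{i\in I}$ a connection policy for $H$ complying with a connection model $\mathrm{CM}$ for $H$, and $S=\mathcal{MC}(\{S_i\}_{i\in I},\mathbb K)$. Let $s=(\vec q,\vec w)\in\mathsf{RC}(S)$. Then: (i) for each $i\in I$, if $q_{h_i}\notin\widehat Q_{h_i}$ then $s|_i\in\mathsf{RC}(S_i)$; (ii) if $q_{h_i}\notin\widehat Q_{h_i}$ for every $i\in I$, then $s|_{\mathbb K}\in\mathsf{RC}(\mathbb K)$.
   Context: Participant names and messages are drawn from countably infinite sets. For finite $\mathbf P$, $\mathbb A$, channels are $C_{\mathbf P}=\{pq\mid p,q\in\mathbf P,p\neq q\}$; actions are $pq!a$ (send $a$ on channel $pq$; subject $p$) and $pq?a$ (consume $a$ from $pq$; subject $q$). A CFSM is $M=(Q,q_0,\mathbb A,\delta)$, $Q$ finite, $\delta\subseteq Q\times\mathit{Act}\times Q$, all actions with the same subject (the name of $M$). $\mathrm{in}(h)$, $\mathrm{out}(h)$ are the messages in input, resp. output, actions of the machine named $h$. A communicating system over $\mathbf P,\mathbb A$ is $(M_p)_{p\in\mathbf P}$ with $M_p=(Q_p,q_{0p},\mathbb A,\delta_p)$ named $p$. A configuration is $(\vec q,\vec w)$ with $\vec q=(q_p)_{p\in\mathbf P}$, $q_p\in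 Q_p$, $\vec w=(w_{pq})_{pq\in C_{\mathbf P}}$, $w_{pq}\in\mathbb A^*$; the initial one is $((q_{0p})_p,\vec\varepsilon)$. Transitions: on $sr!a$ with $(q_s,sr!a,q'_s)\in\delta_s$, $s$ moves and $a$ is appended to $w_{sr}$; on $sr?a$ with $(q_r,sr?a,q'_r)\in\delta_r$ and $w_{sr}=a\cdot w'_{sr}$, $r$ moves and $a$ is removed; everything else unchanged (FIFO channels). $\mathsf{RC}(\cdot)$ denotes the set of configurations reachable from the initial one. A connection model for $H$ is $\mathrm{CM}\subseteq H\times\text{Messages}\times H$ such that for each $h\in H$ and message $a$: $a\in\mathrm{in}(h)$ implies some $h'\neq h$ in $H$ with $a\in\mathrm{out}(h')$ and $(h,a,h')\in\mathrm{CM}$; $a\in\mathrm{out}(h)$ implies some $h'\neq h$ with $a\in\mathrm{in}(h')$ and $(h',a,h)\in\mathrm{CM}$. For each $i$, $k_i$ is a fresh name. For $M_{h_i}=(Q,q_0,\mathbb A,\delta)$, its local connection policy set is the set of CFSMs named $k_i$ of the form $(\dot Q,\dot q_0,\mathbb A,\dot\delta)$, $\dot Q=\{\dot q\mid q\in Q\}$ a copy of $Q$, with $\dot\delta$ minimal such that: for every $(q,rh_i?a,q')\in\delta$ there is $j\neq i$ with $(\dot q,k_ik_j!a,\dot q')\in\dot\delta$ and $(h_i,a,h_j)\in\mathrm{CM}$; for every $(q,h_ir!a,q')\in\delta$ there is $j\neq i$ with $(\dot q,k_jk_i?a,\dot q')\in\dot\delta$ and $(h_j,a,h_i)\in\mathrm{CM}$.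 A connection policy complying with $\mathrm{CM}$ is a communicating system $\mathbb K=(M_{k_i})_{i\in I}$ with each $M_{k_i}$ in the local connection policy set of $M_{h_i}$. Gateway $M_{h_i}\looparrowleft M_{k_i}=(Q\cup\widehat Q_{h_i},q_0,\mathbb A,\widehat\delta)$ where $\widehat Q_{h_i}=\{q^{(q,l,q')}\mid (q,l,q')\in\delta\}$ are fresh states and $\widehat\delta$ contains: for each $(q,h_is!a,q')\in\delta$ and $(\dot q,k_jk_i?a,\dot q')\in\dot\delta$, transitions $(q,h_jh_i?a,\hat q)$, $(\hat q,h_is!a,q')$ with $\hat q=q^{(q,h_is!a,q')}$; for each $(q,sh_i?a,q')\in\delta$ and $(\dot q,k_ik_j!a,\dot q')\in\dot\delta$, transitions $(q,sh_i?a,\hat q)$, $(\hat q,h_ih_j!a,q')$ with $\hat q=q^{(q,sh_i?a,q')}$. The multicomposition $\mathcal{MC}(\{S_i\}_{i\in I},\mathbb K)$ is the system over $\mathbf P=\bigcup_i\mathbf P_i$, $\mathbb A=\bigcup_i\mathbb A_i$ consisting of $M_p$ for $p\notin H$ and $M_{h_i}\looparrowleft M_{k_i}$ for each $h_i$. Projections of a configuration $s=(\vec q,\vec w)$ of $S$: $s|_i=((q_p)_{p\in\mathbf P_i},(w_{pq})_{pq\in C_{\mathbf P_i}})$. If $q_{h_i}\notin\widehat Q_{h_i}$ for all $i$, then $s|_{\mathbb K}=((\dot{q}_{h_i})_{i\in I},(w'_{k_ik_j})_{i\neq j})$, where $\dot q_{h_i}$ is the copy in $\dot Q$ of the local state $q_{h_i}$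 and $w'_{k_ik_j}=w_{h_ih_j}$. -}

module Defs where

open import Data.Nat using (ℕ; _≟_)
open import Data.Fin using (Fin)
open import Data.List using (List; []; _∷_; _++_; [_]; concatMap; map; allFin)
open import Data.List.Membership.Propositional using (_∈_; _∉_)
open import Data.List.Relation.Binary.Subset.Propositional using (_⊆_)
open import Data.Product using (Σ; ∃; _×_; _,_)
open import Relation.Nullary using (¬_; yes; no)
open import Relation.Binary.PropositionalEquality using (_≡_; _≢_)

Name : Set
Name = ℕ

Msg : Set
Msg = ℕ

-- Actions: send p q a  is  pq!a  (subject p);  recv p q a  is  pq?a  (subject q)
data Act : Set where
  send : Name → Name → Msg → Act
  recv : Name → Name → Msg → Act

subject : Act → Name
subject (send p q a) = p
subject (recv p q a) = q

chanOf : Act → Name × Name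
chanOf (send p q a) = p , q
chanOf (recv p q a) = p , q

msgOf : Act → Msg
msgOf (send p q a) = a
msgOf (recv p q a) = a

Trans : Set
Trans = ℕ × Act × ℕ

record CFSM : Set where
  field
    Q  : List ℕ
    q₀ : ℕ
    δ  : List Trans
open CFSM public

record System : Set where
  field
    P : List Name
    A : List Msg
    M : Name → CFSM
open System public

WFMachine : List Name → List Msg → Name → CFSM → Set
WFMachine Ps As x m =
  q₀ m ∈ Q m ×
  (∀ q l q' → (q , l , q') ∈ δ m →
     q ∈ Q m × q' ∈ Q m × subject l ≡ x ×
     (Σ Name λ p → Σ Name λ r → chanOf l ≡ (p , r) × p ∈ Ps × r ∈ Ps × p ≢ r) ×
     msgOf l ∈ As)

WFSys : System → Set
WFSys S = ∀ x → x ∈ P S → WFMachine (P S) (A S) x (M S x)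

inMsg : CFSM → Msg → Set
inMsg m a = Σ ℕ λ q → Σ Name λ p → Σ Name λ r → Σ ℕ λ q' → (q , recv p r a , q') ∈ δ m

outMsg : CFSM → Msg → Set
outMsg m a = Σ ℕ λ q → Σ Name λ p → Σ Name λ r → Σ ℕ λ q' → (q , send p r a , q') ∈ δ m

record CSys (St : Set) : Set₁ where
  field
    Ps    : List Name
    Init  : Name → St → Set
    Step  : Name → St → Act → St → Set
open CSys public

record Config (St : Set) : Set where
  constructor ⟨_,_⟩
  field
    st : Name → St
    ch : Name → Name → List Msg
open Config public

upd : {St : Set} → (Name → St) → Name → St → Name → St
upd f p v x with x ≟ p
... | yes _ = v
... | no  _ = f x

updCh : (Name → Name → List Msg) → Name → Name → List Msg → Name → Name → List Msg
updCh g p q w x y with x ≟ p | y ≟ q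
... | yes _ | yes _ = w
... | _     | _     = g x y

module _ {St : Set} (S : CSys St) where
  data Reach : Config St → Set where
    r-init : ∀ {c} → (∀ x → x ∈ Ps S → Init S x (st c x)) → (∀ x y → ch c x y ≡ []) → Reach c
    r-send : ∀ {c p q a s'} → Reach c → p ∈ Ps S → Step S p (st c p) (send p q a) s' →
             Reach ⟨ upd (st c) p s' , updCh (ch c) p q (ch c p q ++ [ a ]) ⟩
    r-recv : ∀ {c p q a w s'} → Reach c → q ∈ Ps S → Step S q (st c q) (recv p q a) s' →
             ch c p q ≡ a ∷ w →
             Reach ⟨ upd (st c) q s' , updCh (ch c) p q w ⟩

-- configurations are tuples indexed by P (states) and C_P (channels):
-- two total representations denote the same configuration iff they agree there
AgreeOn : {St : Set} → List Name → Config St → Config St → Set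
AgreeOn Ps c d =
  (∀ x → x ∈ Ps → st c x ≡ st d x) ×
  (∀ x y → x ∈ Ps → y ∈ Ps → x ≢ y → ch c x y ≡ ch d x y)

_∈RC_ : {St : Set} → Config St → CSys St → Set
_∈RC_ {St} s S = Σ (Config St) λ c → Reach S c × AgreeOn (Ps S) c s

⟦_⟧ : System → CSys ℕ
⟦ S ⟧ = record
  { Ps   = P S
  ; Init = λ x q → q ≡ q₀ (M S x)
  ; Step = λ x q l q' → (q , l , q') ∈ δ (M S x)
  }

module _ (n : ℕ) (S : Fin n → System) (h : Fin n → Name) where

  Mh : Fin n → CFSM
  Mh i = M (S i) (h i)

  -- CM ⊆ H × Msg × H, given with H indexed by I:  CM i a j  means (h_i,a,h_j) ∈ CM
  IsConnModel : (Fin n → Msg → Fin n → Set) → Set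
  IsConnModel CM =
    (∀ i a → inMsg (Mh i) a → Σ (Fin n) λ j → j ≢ i × outMsg (Mh j) a × CM i a j) ×
    (∀ i a → outMsg (Mh i) a → Σ (Fin n) λ j → j ≢ i × inMsg (Mh j) a × CM j a i)

  module _ (k : Fin n → Name) (CM : Fin n → Msg → Fin n → Set) where

    -- the closure condition on δ̇ (dotted state q̇ represented by q itself)
    PolicyCond : Fin n → List Trans → Set
    PolicyCond i D =
      (∀ q r a q' → (q , recv r (h i) a , q') ∈ δ (Mh i) →
         Σ (Fin n) λ j → j ≢ i × (q , send (k i) (k j) a , q') ∈ D × CM i a j) ×
      (∀ q r a q' → (q , send (h i) r a , q') ∈ δ (Mh i) →
         Σ (Fin n) λ j → j ≢ i × (q , recv (k j) (k i) a , q') ∈ D × CM j a i)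

    InLocalPolicySet : Fin n → CFSM → Set
    InLocalPolicySet i m =
      Q m ≡ Q (Mh i) × q₀ m ≡ q₀ (Mh i) ×
      PolicyCond i (δ m) ×
      (∀ D → D ⊆ δ m → PolicyCond i D → δ m ⊆ D)

    IsConnPolicy : System → Set
    IsConnPolicy K =
      (∀ x → x ∈ P K → Σ (Fin n) λ i → x ≡ k i) ×
      (∀ i → k i ∈ P K) ×
      (∀ i → InLocalPolicySet i (M K (k i)))

  module _ (k : Fin n → Name) (K : System) where

    data GSt : Set where
      base : ℕ → GSt
      hat  : Trans → GSt

    Mk : Fin n → CFSM
    Mk i = M K (k i)

    data Gw (i : Fin n) : GSt → Act → GSt → Set where
      o₁ : ∀ {q s a q' j} → (q , send (h i) s a , q') ∈ δ (Mh i) →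
           (q , recv (k j) (k i) a , q') ∈ δ (Mk i) →
           Gw i (base q) (recv (h j) (h i) a) (hat (q , send (h i) s a , q'))
      o₂ : ∀ {q s a q' j} → (q , send (h i) s a , q') ∈ δ (Mh i) →
           (q , recv (k j) (k i) a , q') ∈ δ (Mk i) →
           Gw i (hat (q , send (h i) s a , q')) (send (h i) s a) (base q')
      i₁ : ∀ {q s a q' j} → (q , recv s (h i) a , q') ∈ δ (Mh i) →
           (q , send (k i) (k j) a , q') ∈ δ (Mk i) →
           Gw i (base q) (recv s (h i) a) (hat (q , recv s (h i) a , q'))
      i₂ : ∀ {q s a q' j} → (q , recv s (h i) a , q') ∈ δ (Mh i) →
           (q , send (k i) (k j) a , q') ∈ δ (Mk i) →
           Gw i (hat (q , recv s (h i) a , q')) (send (h i) (h j) a) (base q')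

    data MCStep : Name → GSt → Act → GSt → Set where
      plain : ∀ {i x q l q'} → x ∈ P (S i) → (∀ j → x ≢ h j) →
              (q , l , q') ∈ δ (M (S i) x) → MCStep x (base q) l (base q')
      gate  : ∀ {i s l s'} → Gw i s l s' → MCStep (h i) s l s'

    MC : CSys GSt
    MC = record
      { Ps   = concatMap (λ i → P (S i)) (allFin n)
      ; Init = λ x s → Σ (Fin n) λ i → x ∈ P (S i) × s ≡ base (q₀ (M (S i) x))
      ; Step = MCStep
      }

    InHat : Fin n → GSt → Set
    InHat i s = Σ Trans λ t → t ∈ δ (Mh i) × s ≡ hat t

    unbase : GSt → ℕ
    unbase (base q) = q
    unbase (hat _)  = 0   -- never used on the states where projections are taken

    proj : Config GSt → Config ℕ
    proj s = ⟨ (λ x → unbase (st s x)) , ch s ⟩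

    ProjK∈RC : Config GSt → Set
    ProjK∈RC s = Σ (Config ℕ) λ c → Reach ⟦ K ⟧ c ×
      (∀ i → st c (k i) ≡ unbase (st s (h i))) ×
      (∀ i j → i ≢ j → ch c (k i) (k j) ≡ ch s (h i) (h j))

module Submission where

-- Both parts are simulation arguments along a run of the multicomposition. A gateway state
-- q^(q,l,q') is read back as a state of M_{h_i} (relᴵ) and as a state of the policy M_{k_i}
-- (relᴷ). Under these readings every step of the composition is either a step of S_i (resp. of K)
-- with the same effect on the channels it owns, or invisible to it: the half of a forwarding that
-- talks to another interface uses a channel outside C_{P_i}, while the half that talks inside S_i,
-- like every step of a non-interface participant, changes neither the state read by K nor a
-- channel between interfaces. Gateway states occur only at interfaces, so when h_i is not in one
-- the readings coincide with the projections.

open import Defs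
open import Data.Nat using (ℕ; _≟_)
open import Data.Fin using (Fin)
import Data.Fin.Properties as Fin
open import Data.List using (List; []; _∷_; _++_; [_])
open import Data.List.Membership.Propositional using (_∈_; _∉_; lose)
open import Data.List.Membership.Propositional.Properties using (∈-concatMap⁺; ∈-allFin)
open import Data.List.Membership.DecPropositional _≟_ using (_∈?_)
open import Data.Product using (Σ; _×_; _,_; proj₁; proj₂)
open import Data.Empty using (⊥-elim)
open import Function using (_∘_; id)
open import Relation.Nullary using (¬_; yes; no)
open import Relation.Binary.PropositionalEquality
  using (_≡_; _≢_; refl; sym; trans; cong; subst)

upd-cong : ∀ {St : Set} {f f' : Name → St} {p p' x x' v} →
           (x ≡ p → x' ≡ p') → (x' ≡ p' → x ≡ p) → f x ≡ f' x' →
           upd f p v x ≡ upd f' p' v x'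
upd-cong {p = p} {p'} {x} {x'} to from eq with x ≟ p | x' ≟ p'
... | yes _  | yes _   = refl
... | yes e  | no x'≢p' = ⊥-elim (x'≢p' (to e))
... | no x≢p | yes e   = ⊥-elim (x≢p (from e))
... | no _   | no _    = eq

upd-id : ∀ {St : Set} (f : Name → St) p v x → (x ≡ p → f x ≡ v) → upd f p v x ≡ f x
upd-id f p v x same with x ≟ p
... | yes e = sym (same e)
... | no _  = refl

∘-upd : ∀ {A B : Set} (F : A → B) (f : Name → A) p v x →
        F (upd f p v x) ≡ upd (F ∘ f) p (F v) x
∘-upd F f p v x with x ≟ p
... | yes _ = refl
... | no _  = refl

updCh-cong : ∀ {g g' : Name → Name → List Msg} {p q p' q' w w' x y x' y'} →
             (x ≡ p → x' ≡ p') → (x' ≡ p' → x ≡ p) →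
             (y ≡ q → y' ≡ q') → (y' ≡ q' → y ≡ q) →
             w ≡ w' → g x y ≡ g' x' y' →
             updCh g p q w x y ≡ updCh g' p' q' w' x' y'
updCh-cong {p = p} {q} {p'} {q'} {x = x} {y} {x'} {y'} x→ x← y→ y← ew eg
  with x ≟ p | y ≟ q | x' ≟ p' | y' ≟ q'
... | yes _ | yes _ | yes _ | yes _ = ew
... | yes e | _     | no ne | _     = ⊥-elim (ne (x→ e))
... | no ne | _     | yes e | _     = ⊥-elim (ne (x← e))
... | _     | yes e | _     | no ne = ⊥-elim (ne (y→ e))
... | _     | no ne | _     | yes e = ⊥-elim (ne (y← e))
... | yes _ | no _  | yes _ | no _  = eg
... | no _  | yes _ | no _  | yes _ = eg
... | no _  | no _  | no _  | no _  = eg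

updCh-id : ∀ (g : Name → Name → List Msg) p q w x y →
           ¬ (x ≡ p × y ≡ q) → updCh g p q w x y ≡ g x y
updCh-id g p q w x y ne with x ≟ p | y ≟ q
... | yes e₁ | yes e₂ = ⊥-elim (ne (e₁ , e₂))
... | yes _  | no _   = refl
... | no _   | yes _  = refl
... | no _   | no _   = refl

mapConfig : {A B : Set} → (A → B) → Config A → Config B
mapConfig F c = ⟨ F ∘ st c , ch c ⟩

module _ {St : Set} (Ps : List Name) where

  AgreeOn-trans : {c d e : Config St} → AgreeOn Ps c d → AgreeOn Ps d e → AgreeOn Ps c e
  AgreeOn-trans (st₁ , ch₁) (st₂ , ch₂) =
    (λ x x∈ → trans (st₁ x x∈) (st₂ x x∈)) ,
    (λ x y x∈ y∈ x≢y → trans (ch₁ x y x∈ y∈ x≢y) (ch₂ x y x∈ y∈ x≢y))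

  AgreeOn-upd : ∀ (c : Config St) {r v p q w} →
                (r ∈ Ps → st c r ≡ v) → (p ∈ Ps → q ∈ Ps → p ≡ q) →
                AgreeOn Ps c ⟨ upd (st c) r v , updCh (ch c) p q w ⟩
  AgreeOn-upd c {r} {v} {p} {q} {w} same loop =
    (λ x x∈ → sym (upd-id (st c) r v x (λ { refl → same x∈ }))) ,
    (λ x y x∈ y∈ x≢y →
       sym (updCh-id (ch c) p q w x y (λ { (refl , refl) → x≢y (loop x∈ y∈) })))

  mapConfig-upd : ∀ {A : Set} (F : A → St) (f : Name → A) p v g →
                  AgreeOn Ps ⟨ upd (F ∘ f) p (F v) , g ⟩ (mapConfig F ⟨ upd f p v , g ⟩)
  mapConfig-upd F f p v g = (λ x _ → sym (∘-upd F f p v x)) , (λ _ _ _ _ _ → refl)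

module _ {St : Set} (T : CSys St) where

  ∈RC-resp : ∀ {c d} → c ∈RC T → AgreeOn (Ps T) c d → d ∈RC T
  ∈RC-resp (e , R , agree) c≈d = e , R , AgreeOn-trans (Ps T) agree c≈d

  ∈RC-send : ∀ {d p q a v} → d ∈RC T → p ∈ Ps T → q ∈ Ps T → p ≢ q →
             Step T p (st d p) (send p q a) v →
             ⟨ upd (st d) p v , updCh (ch d) p q (ch d p q ++ [ a ]) ⟩ ∈RC T
  ∈RC-send {d} {p} {q} {a} {v} (c , R , (stAg , chAg)) p∈ q∈ p≢q step =
    ⟨ upd (st c) p v , updCh (ch c) p q (ch c p q ++ [ a ]) ⟩ ,
    r-send R p∈ (subst (λ z → Step T p z (send p q a) v) (sym (stAg p p∈)) step) ,
    (λ x x∈ → upd-cong {f = st c} {st d} {p} {p} {x} {x} id id (stAg x x∈)) ,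
    (λ x y x∈ y∈ x≢y → updCh-cong {g = ch c} {ch d} {p} {q} {p} {q} {x = x} {y} {x} {y} id id id id
       (cong (_++ [ a ]) (chAg p q p∈ q∈ p≢q)) (chAg x y x∈ y∈ x≢y))

  ∈RC-recv : ∀ {d p q a w v} → d ∈RC T → p ∈ Ps T → q ∈ Ps T → p ≢ q →
             Step T q (st d q) (recv p q a) v → ch d p q ≡ a ∷ w →
             ⟨ upd (st d) q v , updCh (ch d) p q w ⟩ ∈RC T
  ∈RC-recv {d} {p} {q} {a} {w} {v} (c , R , (stAg , chAg)) p∈ q∈ p≢q step queue =
    ⟨ upd (st c) q v , updCh (ch c) p q w ⟩ ,
    r-recv R q∈ (subst (λ z → Step T q z (recv p q a) v) (sym (stAg q q∈)) step)
                (trans (chAg p q p∈ q∈ p≢q) queue) ,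
    (λ x x∈ → upd-cong {f = st c} {st d} {q} {q} {x} {x} id id (stAg x x∈)) ,
    (λ x y x∈ y∈ x≢y → updCh-cong {g = ch c} {ch d} {p} {q} {p} {q} {x = x} {y} {x} {y} id id id id
       refl (chAg x y x∈ y∈ x≢y))

module Multicomposition (n : ℕ) (S : Fin n → System) (h k : Fin n → Name) (K : System)
  (wf : ∀ i → WFSys (S i))
  (disjoint : ∀ i j → i ≢ j → ∀ x → x ∈ P (S i) → x ∉ P (S j))
  (h∈P : ∀ i → h i ∈ P (S i)) where

  MCS : CSys (GSt n S h k K)
  MCS = MC n S h k K

  owner-unique : ∀ {x i j} → x ∈ P (S i) → x ∈ P (S j) → i ≡ j
  owner-unique {x} {i} {j} x∈i x∈j with i Fin.≟ j
  ... | yes i≡j = i≡j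
  ... | no i≢j  = ⊥-elim (disjoint i j i≢j x x∈i x∈j)

  h-owner : ∀ {i j} → h i ∈ P (S j) → i ≡ j
  h-owner h∈ = owner-unique (h∈P _) h∈

  h-injective : ∀ {i j} → h i ≡ h j → i ≡ j
  h-injective {i} {j} e = h-owner (subst (_∈ P (S j)) (sym e) (h∈P j))

  ∈MC : ∀ {x i} → x ∈ P (S i) → x ∈ Ps MCS
  ∈MC {i = i} x∈ = ∈-concatMap⁺ (λ j → P (S j)) (lose (∈-allFin i) x∈)

  not-interface : ∀ {i x} → x ∈ P (S i) → x ≢ h i → ∀ j → x ≢ h j
  not-interface x∈ x≢hi j refl = x≢hi (cong h (h-owner x∈))

  LocalChannel : Fin n → Name × Name → Set
  LocalChannel i (p , r) = p ∈ P (S i) × r ∈ P (S i) × p ≢ r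

  channel-local : ∀ {i x q l q'} → x ∈ P (S i) → (q , l , q') ∈ δ (M (S i) x) →
                  LocalChannel i (chanOf l)
  channel-local {i} {x} {q} {l} {q'} x∈ tr with proj₂ (wf i x x∈) q l q' tr
  ... | _ , _ , _ , (_ , _ , e , local) , _ rewrite e = local

  hat-after-step : ∀ {x g l g' t} → MCStep n S h k K x g l g' → g' ≡ hat t →
                   Σ (Fin n) λ j → x ≡ h j × t ∈ δ (Mh n S h j)
  hat-after-step (plain _ _ _)     ()
  hat-after-step (gate (o₁ tr _)) refl = _ , refl , tr
  hat-after-step (gate (o₂ _ _))   ()
  hat-after-step (gate (i₁ tr _)) refl = _ , refl , tr
  hat-after-step (gate (i₂ _ _))   ()

  hat-at-gateway : ∀ {s} → Reach MCS s → ∀ {x t} → x ∈ Ps MCS → st s x ≡ hat t →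
                   Σ (Fin n) λ j → x ≡ h j × t ∈ δ (Mh n S h j)
  hat-at-gateway (r-init init _) x∈ e with init _ x∈
  ... | _ , _ , e' with trans (sym e) e'
  ...   | ()
  hat-at-gateway (r-send {p = p} R _ step) {x} x∈ e with x ≟ p
  ... | yes refl = hat-after-step step e
  ... | no _     = hat-at-gateway R x∈ e
  hat-at-gateway (r-recv {q = q} R _ step _) {x} x∈ e with x ≟ q
  ... | yes refl = hat-after-step step e
  ... | no _     = hat-at-gateway R x∈ e

  base-off-gateway : ∀ {s i x} → Reach MCS s → x ∈ P (S i) →
                     ¬ InHat n S h k K i (st s (h i)) → Σ ℕ λ q → st s x ≡ base q
  base-off-gateway {s} {i} {x} R x∈ no-hat with st s x in e
  ... | base q = q , refl
  ... | hat t with hat-at-gateway R (∈MC x∈) e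
  ...   | j , refl , t∈ with h-owner x∈
  ...     | refl = ⊥-elim (no-hat (t , t∈ , e))

  reading-off-gateway : ∀ {c s i x} (F : GSt n S h k K → ℕ) → (∀ q → F (base q) ≡ q) →
                        Reach MCS c → AgreeOn (Ps MCS) c s → x ∈ P (S i) →
                        ¬ InHat n S h k K i (st s (h i)) → F (st c x) ≡ unbase n S h k K (st s x)
  reading-off-gateway {c} {s} {i} {x} F F-base R (stAg , _) x∈ no-hat
    with base-off-gateway R x∈ (no-hat ∘ subst (InHat n S h k K i) (stAg (h i) (∈MC (h∈P i))))
  ... | q , e rewrite sym (stAg x (∈MC x∈)) | e = F-base q

  -- A gateway state q^(q,l,q') sits between the two halves of a forwarded message:
  -- for an output S_i has not yet performed l, for an input it already has.
  relᴵ : GSt n S h k K → ℕ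
  relᴵ (base q)                    = q
  relᴵ (hat (q , send _ _ _ , _))  = q
  relᴵ (hat (_ , recv _ _ _ , q')) = q'

  SelfChannel : Fin n → Name × Name → Set
  SelfChannel i (p , r) = p ∈ P (S i) → r ∈ P (S i) → p ≡ r

  data StepViewᴵ (i : Fin n) (x : Name) (l : Act) (g g' : GSt n S h k K) : Set where
    visible : (relᴵ g , l , relᴵ g') ∈ δ (M (S i) x) → LocalChannel i (chanOf l) →
              StepViewᴵ i x l g g'
    silent  : relᴵ g ≡ relᴵ g' → SelfChannel i (chanOf l) → StepViewᴵ i x l g g'

  interfaces-self : ∀ {i j j'} → SelfChannel i (h j , h j')
  interfaces-self h∈ h'∈ = cong h (trans (h-owner h∈) (sym (h-owner h'∈)))

  viewᴵ : ∀ {i x g l g'} → x ∈ P (S i) → MCStep n S h k K x g l g' → StepViewᴵ i x l g g'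
  viewᴵ x∈ (plain x∈' _ tr) with owner-unique x∈' x∈
  ... | refl = visible tr (channel-local x∈ tr)
  viewᴵ x∈ (gate (o₁ _ _))  = silent refl interfaces-self
  viewᴵ x∈ (gate (o₂ tr _)) with h-owner x∈
  ... | refl = visible tr (channel-local x∈ tr)
  viewᴵ x∈ (gate (i₁ tr _)) with h-owner x∈
  ... | refl = visible tr (channel-local x∈ tr)
  viewᴵ x∈ (gate (i₂ _ _))  = silent refl interfaces-self

  module _ (i : Fin n) where

    send-preservesᴵ : ∀ {c p q a g'} → mapConfig relᴵ c ∈RC ⟦ S i ⟧ →
                      MCStep n S h k K p (st c p) (send p q a) g' →
                      ⟨ upd (relᴵ ∘ st c) p (relᴵ g') , updCh (ch c) p q (ch c p q ++ [ a ]) ⟩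
                        ∈RC ⟦ S i ⟧
    send-preservesᴵ {c} {p} IH step with p ∈? P (S i)
    ... | no p∉ = ∈RC-resp _ IH (AgreeOn-upd _ _ (⊥-elim ∘ p∉) (λ p∈ _ → ⊥-elim (p∉ p∈)))
    ... | yes p∈ with viewᴵ p∈ step
    ...   | visible tr (_ , q∈ , p≢q) = ∈RC-send _ IH p∈ q∈ p≢q tr
    ...   | silent same self          = ∈RC-resp _ IH (AgreeOn-upd _ _ (λ _ → same) self)

    recv-preservesᴵ : ∀ {c p q a w g'} → mapConfig relᴵ c ∈RC ⟦ S i ⟧ →
                      MCStep n S h k K q (st c q) (recv p q a) g' → ch c p q ≡ a ∷ w →
                      ⟨ upd (relᴵ ∘ st c) q (relᴵ g') , updCh (ch c) p q w ⟩ ∈RC ⟦ S i ⟧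
    recv-preservesᴵ {c} {p} {q} IH step queue with q ∈? P (S i)
    ... | no q∉ = ∈RC-resp _ IH (AgreeOn-upd _ _ (⊥-elim ∘ q∉) (λ _ q∈ → ⊥-elim (q∉ q∈)))
    ... | yes q∈ with viewᴵ q∈ step
    ...   | visible tr (p∈ , _ , p≢q) = ∈RC-recv _ IH p∈ q∈ p≢q tr queue
    ...   | silent same self          = ∈RC-resp _ IH (AgreeOn-upd _ _ (λ _ → same) self)

    reach⇒viewᴵ∈RC : ∀ {s} → Reach MCS s → mapConfig relᴵ s ∈RC ⟦ S i ⟧
    reach⇒viewᴵ∈RC {s} (r-init init empty) =
      ⟨ relᴵ ∘ st s , (λ _ _ → []) ⟩ , r-init initial (λ _ _ → refl) ,
      (λ _ _ → refl) , (λ x y _ _ _ → sym (empty x y))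
      where
        initial : ∀ x → x ∈ P (S i) → relᴵ (st s x) ≡ q₀ (M (S i) x)
        initial x x∈ with init x (∈MC x∈)
        ... | _ , x∈' , e with owner-unique x∈' x∈
        ...   | refl rewrite e = refl
    reach⇒viewᴵ∈RC (r-send {c} {p} {s' = g'} R _ step)
      = ∈RC-resp _ (send-preservesᴵ {c} (reach⇒viewᴵ∈RC R) step)
                   (mapConfig-upd _ relᴵ (st c) p g' _)
    reach⇒viewᴵ∈RC (r-recv {c} {q = q} {s' = g'} R _ step queue)
      = ∈RC-resp _ (recv-preservesᴵ {c} (reach⇒viewᴵ∈RC R) step queue)
                   (mapConfig-upd _ relᴵ (st c) q g' _)

  proj∈RC : ∀ {s i} → s ∈RC MCS → ¬ InHat n S h k K i (st s (h i)) →
            proj n S h k K s ∈RC ⟦ S i ⟧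
  proj∈RC {i = i} (c , R , agree@(_ , chAg)) no-hat =
    ∈RC-resp _ (reach⇒viewᴵ∈RC i R)
      ( (λ x x∈ → reading-off-gateway relᴵ (λ _ → refl) R agree x∈ no-hat)
      , (λ x y x∈ y∈ → chAg x y (∈MC x∈) (∈MC y∈)) )

  module Policy (k-injective : ∀ {i j} → k i ≡ k j → i ≡ j) (k∈P : ∀ i → k i ∈ P K)
                (k-initial : ∀ i → q₀ (M K (k i)) ≡ q₀ (Mh n S h i)) where

    -- Dually to relᴵ, the policy has already consumed an output and not yet emitted an input.
    relᴷ : GSt n S h k K → ℕ
    relᴷ (base q)                    = q
    relᴷ (hat (_ , send _ _ _ , q')) = q'
    relᴷ (hat (q , recv _ _ _ , _))  = q

    k→h : ∀ {i j} → k i ≡ k j → h i ≡ h j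
    k→h = cong h ∘ k-injective

    h→k : ∀ {i j} → h i ≡ h j → k i ≡ k j
    h→k = cong k ∘ h-injective

    _≈ᴷ_ : Config ℕ → Config (GSt n S h k K) → Set
    d ≈ᴷ s = (∀ i → st d (k i) ≡ relᴷ (st s (h i))) ×
             (∀ i j → ch d (k i) (k j) ≡ ch s (h i) (h j))

    OffInterfaces : Name × Name → Set
    OffInterfaces (p , r) = ∀ i j → ¬ (h i ≡ p × h j ≡ r)

    data StepViewᴷ : Name → Act → GSt n S h k K → GSt n S h k K → Set where
      sendᴷ   : ∀ i j {a g g'} → (relᴷ g , send (k i) (k j) a , relᴷ g') ∈ δ (M K (k i)) →
                StepViewᴷ (h i) (send (h i) (h j) a) g g'
      recvᴷ   : ∀ i j {a g g'} → (relᴷ g , recv (k j) (k i) a , relᴷ g') ∈ δ (M K (k i)) →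
                StepViewᴷ (h i) (recv (h j) (h i) a) g g'
      silentᴷ : ∀ {x l g g'} → (∀ i → h i ≡ x → relᴷ g ≡ relᴷ g') → OffInterfaces (chanOf l) →
                StepViewᴷ x l g g'

    viewᴷ : ∀ {x g l g'} → MCStep n S h k K x g l g' → subject l ≡ x → StepViewᴷ x l g g'
    viewᴷ {l = send _ _ _} (plain _ not-h _) refl =
      silentᴷ (λ i e → ⊥-elim (not-h i (sym e))) (λ i _ (e , _) → not-h i (sym e))
    viewᴷ {l = recv _ _ _} (plain _ not-h _) refl =
      silentᴷ (λ i e → ⊥-elim (not-h i (sym e))) (λ _ j (_ , e) → not-h j (sym e))
    viewᴷ (gate (o₁ _ trᴷ)) _ = recvᴷ _ _ trᴷ
    viewᴷ (gate {i} (o₂ tr _)) _ with channel-local (h∈P i) tr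
    ... | _ , r∈ , hi≢r =
      silentᴷ (λ _ _ → refl) (λ _ j (_ , e) → not-interface r∈ (hi≢r ∘ sym) j (sym e))
    viewᴷ (gate {i} (i₁ tr _)) _ with channel-local (h∈P i) tr
    ... | p∈ , _ , p≢hi =
      silentᴷ (λ _ _ → refl) (λ j _ (e , _) → not-interface p∈ p≢hi j (sym e))
    viewᴷ (gate (i₂ _ trᴷ)) _ = sendᴷ _ _ trᴷ

    ≈ᴷ-upd : ∀ {d s i j₁ j₂ v w w'} → d ≈ᴷ s → w ≡ w' →
             ⟨ upd (st d) (k i) (relᴷ v) , updCh (ch d) (k j₁) (k j₂) w ⟩ ≈ᴷ
             ⟨ upd (st s) (h i) v , updCh (ch s) (h j₁) (h j₂) w' ⟩
    ≈ᴷ-upd {s = s} {i} {v = v} (stR , chR) w≡w' =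
      (λ i' → trans (upd-cong k→h h→k (stR i')) (sym (∘-upd relᴷ (st s) (h i) v (h i')))) ,
      (λ i' j' → updCh-cong k→h h→k k→h h→k w≡w' (chR i' j'))

    ≈ᴷ-silent : ∀ {d s r v p q w} → d ≈ᴷ s → (∀ i → h i ≡ r → relᴷ (st s r) ≡ relᴷ v) →
                OffInterfaces (p , q) → d ≈ᴷ ⟨ upd (st s) r v , updCh (ch s) p q w ⟩
    ≈ᴷ-silent {s = s} {r} {v} {p} {q} {w} (stR , chR) same off =
      (λ i → trans (stR i) (sym (unchanged i))) ,
      (λ i j → trans (chR i j) (sym (updCh-id (ch s) p q w (h i) (h j) (off i j))))
      where
        unchanged : ∀ i → relᴷ (upd (st s) r v (h i)) ≡ relᴷ (st s (h i))
        unchanged i = trans (∘-upd relᴷ (st s) r v (h i))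
                            (upd-id (relᴷ ∘ st s) r (relᴷ v) (h i) (λ { refl → same i refl }))

    Simulatedᴷ : Config (GSt n S h k K) → Set
    Simulatedᴷ s = Σ (Config ℕ) λ d → Reach ⟦ K ⟧ d × d ≈ᴷ s

    reach⇒simulatedᴷ : ∀ {s} → Reach MCS s → Simulatedᴷ s
    reach⇒simulatedᴷ {s} (r-init init empty) =
      ⟨ q₀ ∘ M K , (λ _ _ → []) ⟩ , r-init (λ _ _ → refl) (λ _ _ → refl) ,
      initial , (λ i j → sym (empty (h i) (h j)))
      where
        initial : ∀ i → q₀ (M K (k i)) ≡ relᴷ (st s (h i))
        initial i with init (h i) (∈MC (h∈P i))
        ... | _ , h∈ , e with h-owner h∈
        ...   | refl rewrite e = k-initial i
    reach⇒simulatedᴷ (r-send {a = a} {s' = g'} R _ step)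
      with reach⇒simulatedᴷ R | viewᴷ step refl
    ... | d , Rd , rel | sendᴷ i j tr =
      ⟨ upd (st d) (k i) (relᴷ g') , updCh (ch d) (k i) (k j) (ch d (k i) (k j) ++ [ a ]) ⟩ ,
      r-send Rd (k∈P i) (subst (λ z → (z , send (k i) (k j) a , relᴷ g') ∈ δ (M K (k i)))
                               (sym (proj₁ rel i)) tr) ,
      ≈ᴷ-upd rel (cong (_++ [ a ]) (proj₂ rel i j))
    ... | d , Rd , rel | silentᴷ same off = d , Rd , ≈ᴷ-silent {d} rel same off
    reach⇒simulatedᴷ (r-recv {a = a} {w} {g'} R _ step queue)
      with reach⇒simulatedᴷ R | viewᴷ step refl
    ... | d , Rd , rel | recvᴷ i j tr =
      ⟨ upd (st d) (k i) (relᴷ g') , updCh (ch d) (k j) (k i) w ⟩ ,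
      r-recv Rd (k∈P i) (subst (λ z → (z , recv (k j) (k i) a , relᴷ g') ∈ δ (M K (k i)))
                               (sym (proj₁ rel i)) tr)
                        (trans (proj₂ rel j i) queue) ,
      ≈ᴷ-upd rel refl
    ... | d , Rd , rel | silentᴷ same off = d , Rd , ≈ᴷ-silent {d} rel same off

    projᴷ∈RC : ∀ {s} → s ∈RC MCS → (∀ i → ¬ InHat n S h k K i (st s (h i))) →
               ProjK∈RC n S h k K s
    projᴷ∈RC (c , R , agree@(_ , chAg)) no-hat with reach⇒simulatedᴷ R
    ... | d , Rd , (stR , chR) =
      d , Rd ,
      (λ i → trans (stR i) (reading-off-gateway relᴷ (λ _ → refl) R agree (h∈P i) (no-hat i))) ,
      (λ i j i≢j → trans (chR i j)
                         (chAg (h i) (h j) (∈MC (h∈P i)) (∈MC (h∈P j)) (i≢j ∘ h-injective)))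

proposition5p4 : (n : ℕ) (S : Fin n → System) (h k : Fin n → Name)
    (CM : Fin n → Msg → Fin n → Set) (K : System) →
    (∀ i → WFSys (S i)) →
    (∀ i j → i ≢ j → ∀ x → x ∈ P (S i) → x ∉ P (S j)) →
    (∀ i → h i ∈ P (S i)) →
    (∀ i j → k i ≡ k j → i ≡ j) →
    (∀ i j → k i ∉ P (S j)) →
    IsConnModel n S h CM →
    IsConnPolicy n S h k CM K →
    (s : Config (GSt n S h k K)) → s ∈RC MC n S h k K →
    (∀ i → ¬ InHat n S h k K i (st s (h i)) →
       proj n S h k K s ∈RC ⟦ S i ⟧)
    × ((∀ i → ¬ InHat n S h k K i (st s (h i))) → ProjK∈RC n S h k K s)
proposition5p4 n S h k CM K wf disjoint h∈P k-injective _ _ (_ , k∈P , local) s s∈RC =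
  (λ _ → proj∈RC s∈RC) , projᴷ∈RC s∈RC
  where
    open Multicomposition n S h k K wf disjoint h∈P
    open Policy (k-injective _ _) k∈P (λ i → proj₁ (proj₂ (local i)))
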